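{- (Global substitution, contextual system.) Let $\Psi\vdash\sigma:\Phi$. (1) If $\Phi;\Gamma\vdash_i t:T$, then $\Psi;\Gamma\vdash_i t[\sigma]:T$. (2) If $\Phi;\Gamma\vdash_i\delta:\Delta$, then $\Psi;\Gamma\vdash_i\delta[\sigma]:\Delta$. (3) If $\Phi;\Gamma\vdash_1 b:(\Delta\vdash T\Rightarrow T')$, then $\Psi;\Gamma\vdash_1 b[\sigma]:(\Delta\vdash T\Rightarrow T')$. (4) If $\Phi;\Gamma\vdash_1\vec b:(\Delta\vdash T\Rightarrow T')$, then $\Psi;\Gamma\vdash_1\vec b[\sigma]:(\Delta\vdash T\Rightarrow T')$.
   Context: Types: $T::=\mathsf{Nat}\mid(\Gamma\vdash T)\mid S\to T$. Core types ($\mathrm{core}$): built from $\mathsf{Nat}$, $\to$. Valid types ($\mathrm{type}$): $\mathsf{Nat}$; $S\to T$ with $S,T$ valid; $(\Gamma\vdash T)$ with $\Gamma$ and $T$ core. Local contexts $\Gamma::=\cdot\mid\Gamma,x:T$; global contexts $\Psi,\Phi::=\cdot\mid\Psi,u:(\Gamma\vdash T)$; $\mathrm{core}\,\Psi$ means all types in $\Psi$ (including in local contexts of bindings) are core. Local substitutions $\delta::=\cdot\mid\delta,t/x$. Terms $t::=x\mid u^\delta\mid\mathsf{zero}\mid\mathsf{succ}\,t\mid\mathsf{box}\,t\mid\mathsf{letbox}\,u=s\,\mathsf{in}\,t\mid\mathsf{match}\,t\ \vec b\mid\lambda x.t\mid s\ t$; branches $b::=\mathsf{var}\,x\Rightarrow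 t\mid\mathsf{zero}\Rightarrow t\mid\mathsf{succ}\,?u\Rightarrow t\mid\lambda x.?u\Rightarrow t\mid ?u\ ?u'\Rightarrow t$. Typing ($i\in\{0,1\}$; $C_0$="$\mathrm{core}\,\Psi$, $\mathrm{core}\,\Gamma$", $C_1$="$\mathrm{core}\,\Psi$, $\mathrm{type}\,\Gamma$"): under $C_i$, $\vdash_i\mathsf{zero}:\mathsf{Nat}$, $\vdash_i x:T$ for $x:T\in\Gamma$, $\vdash_i\cdot:\cdot$; $\Psi;\Gamma\vdash_i\delta:\Delta$, $\Psi;\Gamma\vdash_i t:T$ give $\Psi;\Gamma\vdash_i\delta,t/x:\Delta,x:T$; $\Psi;\Gamma\vdash_i\delta:\Delta$, $u:(\Delta\vdash T)\in\Psi$ give $\Psi;\Gamma\vdash_i u^\delta:T$; succ, $\lambda$, application at layer $i$; $\mathrm{type}\,\Gamma$, $\Psi;\Delta\vdash_0 t:T$ give $\Psi;\Gamma\vdash_1\mathsf{box}\,t:(\Delta\vdash T)$; $\Psi;\Gamma\vdash_1 s:(\Delta\vdash T)$ with $\Psi,u:(\Delta\vdash T);\Gamma\vdash_1 t:T'$ gives $\mathsf{letbox}\,u=s\,\mathsf{in}\,t:T'$; $\Psi;\Gamma\vdash_1 s:(\Delta\vdash T)$ with $\Psi;\Gamma\vdash_1\vec b:(\Delta\vdash T\Rightarrow T')$ gives $\mathsf{match}\,s\ \vec b:T'$. Branch typing: $\mathsf{var}\,x\Rightarrow t$ ($\mathrm{core}\,\Delta$, $x:T\in\Delta$, $\Psi;\Gamma\vdash_1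 t:T'$); $\mathsf{zero}\Rightarrow t$ ($T=\mathsf{Nat}$, $\mathrm{core}\,\Delta$, $\Psi;\Gamma\vdash_1 t:T'$); $\mathsf{succ}\,?u\Rightarrow t$ ($T=\mathsf{Nat}$, $\Psi,u:(\Delta\vdash\mathsf{Nat});\Gamma\vdash_1 t:T'$); $\lambda x.?u\Rightarrow t$ ($T=S\to T_0$, $\Psi,u:(\Delta,x:S\vdash T_0);\Gamma\vdash_1 t:T'$); $?u\ ?u'\Rightarrow t$ (for all core $S$, $\Psi,u:(\Delta\vdash S\to T),u':(\Delta\vdash S);\Gamma\vdash_1 t:T'$). Covering $\vec b$: all branches typed and exactly one branch per applicable head ($T=\mathsf{Nat}$: zero, succ, application, $\mathsf{var}\,x$ for each $x:\mathsf{Nat}\in\Delta$; $T=S\to T_0$: $\lambda$, application, $\mathsf{var}\,x$ for each $x:S\to T_0\in\Delta$). Local substitution application: $x[\delta]=\delta(x)$, $u^{\delta'}[\delta]=u^{\delta'\circ\delta}$, $(\mathsf{box}\,t)[\delta]=\mathsf{box}\,t$, $(\lambda x.t)[\delta]=\lambda x.(t[\delta,x/x])$, into match scrutinees and branch bodies, homomorphic otherwise. Global substitutions $\sigma::=\cdot\mid\sigma,t/u$: $\Psi\vdash\cdot:\cdot$ if $\mathrm{core}\,\Psi$; $\Psi\vdash\sigma,t/u:\Phi,u:(\Gamma\vdash T)$ if $\Psi\vdash\sigma:\Phi$ and $\Psi;\Gamma\vdash_0 t:T$. Application: $x[\sigma]=x$, $u^\delta[\sigma]=\sigma(u)[\delta[\sigma]]$,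 $(\mathsf{box}\,t)[\sigma]=\mathsf{box}(t[\sigma])$, $(\mathsf{letbox}\,u=s\,\mathsf{in}\,t)[\sigma]=\mathsf{letbox}\,u=s[\sigma]\,\mathsf{in}\,(t[\sigma,u/u])$, $(\mathsf{match}\,s\ \vec b)[\sigma]=\mathsf{match}\,s[\sigma]\ (\vec b[\sigma])$, homomorphic on $\mathsf{zero},\mathsf{succ},\lambda$, application; $\delta[\sigma]$ pointwise; on branches: $(\mathsf{var}\,x\Rightarrow t)[\sigma]=\mathsf{var}\,x\Rightarrow t[\sigma]$, $(\mathsf{zero}\Rightarrow t)[\sigma]=\mathsf{zero}\Rightarrow t[\sigma]$, $(\mathsf{succ}\,?u\Rightarrow t)[\sigma]=\mathsf{succ}\,?u\Rightarrow t[\sigma,u/u]$, $(\lambda x.?u\Rightarrow t)[\sigma]=\lambda x.?u\Rightarrow t[\sigma,u/u]$, $(?u\ ?u'\Rightarrow t)[\sigma]=?u\ ?u'\Rightarrow t[\sigma,u/u,u'/u']$; $\vec b[\sigma]$ pointwise. -}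

module Defs where

open import Data.Nat using (ℕ; zero; suc)
open import Data.List using (List; []; _∷_; map)
open import Data.List.Relation.Unary.All using (All)
open import Data.List.Membership.Propositional using (_∈_)
open import Data.List.Relation.Unary.Unique.Propositional using (Unique)
open import Data.Product using (_×_; _,_)

data Ty : Set where
  Nat  : Ty
  _⊢ₜ_ : List Ty → Ty → Ty
  _⇒_  : Ty → Ty → Ty

infixr 7 _⇒_
infix  6 _⊢ₜ_

-- local contexts; the head of the list is the most recent binding (index 0)
Ctx : Set
Ctx = List Ty

data Core : Ty → Set where
  c-Nat : Core Nat
  c-⇒   : ∀ {S T} → Core S → Core T → Core (S ⇒ T)

CoreCtx : Ctx → Set
CoreCtx Γ = All Core Γ

data Valid : Ty → Set where
  v-Nat : Valid Nat
  v-⇒   : ∀ {S T} → Valid S → Valid T → Valid (S ⇒ T)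
  v-□   : ∀ {Γ T} → CoreCtx Γ → Core T → Valid (Γ ⊢ₜ T)

TypeCtx : Ctx → Set
TypeCtx Γ = All Valid Γ

-- global contexts: bindings u : (Γ ⊢ T), head = most recent (index 0)
GCtx : Set
GCtx = List (Ctx × Ty)

CoreBinding : Ctx × Ty → Set
CoreBinding (Γ , T) = CoreCtx Γ × Core T

CoreG : GCtx → Set
CoreG Ψ = All CoreBinding Ψ

data _∋_⦂_ {A : Set} : List A → ℕ → A → Set where
  here  : ∀ {a as} → (a ∷ as) ∋ zero ⦂ a
  there : ∀ {a b as n} → as ∋ n ⦂ a → (b ∷ as) ∋ suc n ⦂ a

mutual
  data Tm : Set where
    var    : ℕ → Tm
    gvar   : ℕ → List Tm → Tm
    zero   : Tm
    succ   : Tm → Tm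
    box    : Tm → Tm
    letbox : Tm → Tm → Tm           -- letbox u = s in t  (binds one global)
    match  : Tm → List Br → Tm
    lam    : Tm → Tm                -- binds one local
    app    : Tm → Tm → Tm

  data Br : Set where
    bvar  : ℕ → Tm → Br   -- var x ⇒ t    (x indexes Δ)
    bzero : Tm → Br
    bsucc : Tm → Br       -- succ ?u ⇒ t  (binds global u, index 0)
    blam  : Tm → Br       -- λx.?u ⇒ t    (binds global u, index 0)
    bapp  : Tm → Br       -- ?u ?u' ⇒ t   (binds u (index 1), u' (index 0))

data Layer : Set where
  L0 L1 : Layer

CtxOK : Layer → Ctx → Set
CtxOK L0 Γ = CoreCtx Γ
CtxOK L1 Γ = TypeCtx Γ

data Head : Set where
  hvar : ℕ → Head
  hzero hsucc hlam happ : Head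

headOf : Br → Head
headOf (bvar x _) = hvar x
headOf (bzero _)  = hzero
headOf (bsucc _)  = hsucc
headOf (blam _)   = hlam
headOf (bapp _)   = happ

data Applicable (Δ : Ctx) : Ty → Head → Set where
  a-zero  : Applicable Δ Nat hzero
  a-succ  : Applicable Δ Nat hsucc
  a-appN  : Applicable Δ Nat happ
  a-varN  : ∀ {x} → Δ ∋ x ⦂ Nat → Applicable Δ Nat (hvar x)
  a-lam   : ∀ {S T} → Applicable Δ (S ⇒ T) hlam
  a-appF  : ∀ {S T} → Applicable Δ (S ⇒ T) happ
  a-varF  : ∀ {x S T} → Δ ∋ x ⦂ (S ⇒ T) → Applicable Δ (S ⇒ T) (hvar x)

Covers : Ctx → Ty → List Br → Set
Covers Δ T bs =
  All (λ b → Applicable Δ T (headOf b)) bs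
  × (∀ h → Applicable Δ T h → h ∈ map headOf bs)
  × Unique (map headOf bs)

infix 4 _︔_⊢[_]_∶_ _︔_⊢s[_]_∶_ _︔_⊢ᵇ_∶_▸_⇛_ _︔_⊢ᵇˢ_∶_▸_⇛_

mutual
  data _︔_⊢[_]_∶_ : GCtx → Ctx → Layer → Tm → Ty → Set where
    t-zero : ∀ {Ψ Γ i} → CoreG Ψ → CtxOK i Γ → Ψ ︔ Γ ⊢[ i ] zero ∶ Nat
    t-var  : ∀ {Ψ Γ i x T} → CoreG Ψ → CtxOK i Γ → Γ ∋ x ⦂ T →
             Ψ ︔ Γ ⊢[ i ] var x ∶ T
    t-gvar : ∀ {Ψ Γ i u δ Δ T} → Ψ ︔ Γ ⊢s[ i ] δ ∶ Δ → Ψ ∋ u ⦂ (Δ , T) →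
             Ψ ︔ Γ ⊢[ i ] gvar u δ ∶ T
    t-succ : ∀ {Ψ Γ i t} → Ψ ︔ Γ ⊢[ i ] t ∶ Nat → Ψ ︔ Γ ⊢[ i ] succ t ∶ Nat
    t-lam  : ∀ {Ψ Γ i t S T} → Ψ ︔ (S ∷ Γ) ⊢[ i ] t ∶ T →
             Ψ ︔ Γ ⊢[ i ] lam t ∶ S ⇒ T
    t-app  : ∀ {Ψ Γ i s t S T} → Ψ ︔ Γ ⊢[ i ] s ∶ S ⇒ T → Ψ ︔ Γ ⊢[ i ] t ∶ S →
             Ψ ︔ Γ ⊢[ i ] app s t ∶ T
    t-box  : ∀ {Ψ Γ Δ t T} → TypeCtx Γ → Ψ ︔ Δ ⊢[ L0 ] t ∶ T →
             Ψ ︔ Γ ⊢[ L1 ] box t ∶ (Δ ⊢ₜ T)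
    t-letbox : ∀ {Ψ Γ Δ s t T T'} → Ψ ︔ Γ ⊢[ L1 ] s ∶ (Δ ⊢ₜ T) →
             ((Δ , T) ∷ Ψ) ︔ Γ ⊢[ L1 ] t ∶ T' →
             Ψ ︔ Γ ⊢[ L1 ] letbox s t ∶ T'
    t-match : ∀ {Ψ Γ Δ s bs T T'} → Ψ ︔ Γ ⊢[ L1 ] s ∶ (Δ ⊢ₜ T) →
             Ψ ︔ Γ ⊢ᵇˢ bs ∶ Δ ▸ T ⇛ T' →
             Ψ ︔ Γ ⊢[ L1 ] match s bs ∶ T'

  data _︔_⊢s[_]_∶_ : GCtx → Ctx → Layer → List Tm → Ctx → Set where
    s-nil  : ∀ {Ψ Γ i} → CoreG Ψ → CtxOK i Γ → Ψ ︔ Γ ⊢s[ i ] [] ∶ []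
    s-cons : ∀ {Ψ Γ i δ Δ t T} → Ψ ︔ Γ ⊢s[ i ] δ ∶ Δ → Ψ ︔ Γ ⊢[ i ] t ∶ T →
             Ψ ︔ Γ ⊢s[ i ] (t ∷ δ) ∶ (T ∷ Δ)

  data _︔_⊢ᵇ_∶_▸_⇛_ : GCtx → Ctx → Br → Ctx → Ty → Ty → Set where
    b-var  : ∀ {Ψ Γ Δ x t T T'} → CoreCtx Δ → Δ ∋ x ⦂ T →
             Ψ ︔ Γ ⊢[ L1 ] t ∶ T' → Ψ ︔ Γ ⊢ᵇ bvar x t ∶ Δ ▸ T ⇛ T'
    b-zero : ∀ {Ψ Γ Δ t T'} → CoreCtx Δ →
             Ψ ︔ Γ ⊢[ L1 ] t ∶ T' → Ψ ︔ Γ ⊢ᵇ bzero t ∶ Δ ▸ Nat ⇛ T'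
    b-succ : ∀ {Ψ Γ Δ t T'} → ((Δ , Nat) ∷ Ψ) ︔ Γ ⊢[ L1 ] t ∶ T' →
             Ψ ︔ Γ ⊢ᵇ bsucc t ∶ Δ ▸ Nat ⇛ T'
    b-lam  : ∀ {Ψ Γ Δ t S T₀ T'} → ((S ∷ Δ , T₀) ∷ Ψ) ︔ Γ ⊢[ L1 ] t ∶ T' →
             Ψ ︔ Γ ⊢ᵇ blam t ∶ Δ ▸ (S ⇒ T₀) ⇛ T'
    b-app  : ∀ {Ψ Γ Δ t T T'} →
             (∀ S → Core S → ((Δ , S) ∷ (Δ , S ⇒ T) ∷ Ψ) ︔ Γ ⊢[ L1 ] t ∶ T') →
             Ψ ︔ Γ ⊢ᵇ bapp t ∶ Δ ▸ T ⇛ T'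

  data _︔_⊢ᵇˢ_∶_▸_⇛_ : GCtx → Ctx → List Br → Ctx → Ty → Ty → Set where
    covering : ∀ {Ψ Γ bs Δ T T'} →
             All (λ b → Ψ ︔ Γ ⊢ᵇ b ∶ Δ ▸ T ⇛ T') bs → Covers Δ T bs →
             Ψ ︔ Γ ⊢ᵇˢ bs ∶ Δ ▸ T ⇛ T'

Ren : Set
Ren = ℕ → ℕ

ext : Ren → Ren
ext ρ zero    = zero
ext ρ (suc n) = suc (ρ n)

-- local renaming (does not enter box; branch bodies live in Γ)
mutual
  lren : Ren → Tm → Tm
  lren ρ (var x)      = var (ρ x)
  lren ρ (gvar u δ)   = gvar u (lrens ρ δ)
  lren ρ zero         = zero
  lren ρ (succ t)     = succ (lren ρ t)
  lren ρ (box t)      = box t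
  lren ρ (letbox s t) = letbox (lren ρ s) (lren ρ t)
  lren ρ (match s bs) = match (lren ρ s) (lrenBs ρ bs)
  lren ρ (lam t)      = lam (lren (ext ρ) t)
  lren ρ (app s t)    = app (lren ρ s) (lren ρ t)

  lrens : Ren → List Tm → List Tm
  lrens ρ []      = []
  lrens ρ (t ∷ δ) = lren ρ t ∷ lrens ρ δ

  lrenB : Ren → Br → Br
  lrenB ρ (bvar x t) = bvar x (lren ρ t)
  lrenB ρ (bzero t)  = bzero (lren ρ t)
  lrenB ρ (bsucc t)  = bsucc (lren ρ t)
  lrenB ρ (blam t)   = blam (lren ρ t)
  lrenB ρ (bapp t)   = bapp (lren ρ t)

  lrenBs : Ren → List Br → List Br
  lrenBs ρ []       = []
  lrenBs ρ (b ∷ bs) = lrenB ρ b ∷ lrenBs ρ bs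

mutual
  gren : Ren → Tm → Tm
  gren r (var x)      = var x
  gren r (gvar u δ)   = gvar (r u) (grens r δ)
  gren r zero         = zero
  gren r (succ t)     = succ (gren r t)
  gren r (box t)      = box (gren r t)
  gren r (letbox s t) = letbox (gren r s) (gren (ext r) t)
  gren r (match s bs) = match (gren r s) (grenBs r bs)
  gren r (lam t)      = lam (gren r t)
  gren r (app s t)    = app (gren r s) (gren r t)

  grens : Ren → List Tm → List Tm
  grens r []      = []
  grens r (t ∷ δ) = gren r t ∷ grens r δ

  grenB : Ren → Br → Br
  grenB r (bvar x t) = bvar x (gren r t)
  grenB r (bzero t)  = bzero (gren r t)
  grenB r (bsucc t)  = bsucc (gren (ext r) t)
  grenB r (blam t)   = blam (gren (ext r) t)
  grenB r (bapp t)   = bapp (gren (ext (ext r)) t)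

  grenBs : Ren → List Br → List Br
  grenBs r []       = []
  grenBs r (b ∷ bs) = grenB r b ∷ grenBs r bs

lookupTm : List Tm → ℕ → Tm
lookupTm []      x       = var x     -- unreachable for well-typed terms
lookupTm (t ∷ δ) zero    = t
lookupTm (t ∷ δ) (suc x) = lookupTm δ x

mutual
  lsub : List Tm → Tm → Tm
  lsub δ (var x)      = lookupTm δ x
  lsub δ (gvar u δ')  = gvar u (lsubs δ δ')
  lsub δ zero         = zero
  lsub δ (succ t)     = succ (lsub δ t)
  lsub δ (box t)      = box t
  lsub δ (letbox s t) = letbox (lsub δ s) (lsub δ t)
  lsub δ (match s bs) = match (lsub δ s) (lsubBs δ bs)
  lsub δ (lam t)      = lam (lsub (var zero ∷ lrens suc δ) t)
  lsub δ (app s t)    = app (lsub δ s) (lsub δ t)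

  lsubs : List Tm → List Tm → List Tm
  lsubs δ []       = []
  lsubs δ (t ∷ δ') = lsub δ t ∷ lsubs δ δ'

  lsubB : List Tm → Br → Br
  lsubB δ (bvar x t) = bvar x (lsub δ t)
  lsubB δ (bzero t)  = bzero (lsub δ t)
  lsubB δ (bsucc t)  = bsucc (lsub δ t)
  lsubB δ (blam t)   = blam (lsub δ t)
  lsubB δ (bapp t)   = bapp (lsub δ t)

  lsubBs : List Tm → List Br → List Br
  lsubBs δ []       = []
  lsubBs δ (b ∷ bs) = lsubB δ b ∷ lsubBs δ bs

-- Internally a global substitution maps each global variable either to a
-- term (t/u) or to a global variable kept as-is (the "u/u" entries added
-- when going under a binder of a global variable).

data GEnt : Set where
  keep : ℕ → GEnt
  inst : Tm → GEnt

GSub : Set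
GSub = ℕ → GEnt

shiftEnt : GEnt → GEnt
shiftEnt (keep u) = keep (suc u)
shiftEnt (inst t) = inst (gren suc t)

extG : GSub → GSub
extG σ zero    = keep zero
extG σ (suc u) = shiftEnt (σ u)

toGSub : List Tm → GSub
toGSub []      u       = keep u      -- unreachable for well-typed terms
toGSub (t ∷ σ) zero    = inst t
toGSub (t ∷ σ) (suc u) = toGSub σ u

mutual
  gsub : GSub → Tm → Tm
  gsub σ (var x)      = var x
  gsub σ (gvar u δ)   with σ u
  ... | keep u' = gvar u' (gsubs σ δ)
  ... | inst t  = lsub (gsubs σ δ) t
  gsub σ zero         = zero
  gsub σ (succ t)     = succ (gsub σ t)
  gsub σ (box t)      = box (gsub σ t)
  gsub σ (letbox s t) = letbox (gsub σ s) (gsub (extG σ) t)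
  gsub σ (match s bs) = match (gsub σ s) (gsubBs σ bs)
  gsub σ (lam t)      = lam (gsub σ t)
  gsub σ (app s t)    = app (gsub σ s) (gsub σ t)

  gsubs : GSub → List Tm → List Tm
  gsubs σ []      = []
  gsubs σ (t ∷ δ) = gsub σ t ∷ gsubs σ δ

  gsubB : GSub → Br → Br
  gsubB σ (bvar x t) = bvar x (gsub σ t)
  gsubB σ (bzero t)  = bzero (gsub σ t)
  gsubB σ (bsucc t)  = bsucc (gsub (extG σ) t)
  gsubB σ (blam t)   = blam (gsub (extG σ) t)
  gsubB σ (bapp t)   = bapp (gsub (extG (extG σ)) t)

  gsubBs : GSub → List Br → List Br
  gsubBs σ []       = []
  gsubBs σ (b ∷ bs) = gsubB σ b ∷ gsubBs σ bs

-- user-facing notation: σ is a list of terms (head = substitute for index 0)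
_[_]ᵍ : Tm → List Tm → Tm
t [ σ ]ᵍ = gsub (toGSub σ) t

_[_]ᵍˢ : List Tm → List Tm → List Tm
δ [ σ ]ᵍˢ = gsubs (toGSub σ) δ

_[_]ᵍᵇ : Br → List Tm → Br
b [ σ ]ᵍᵇ = gsubB (toGSub σ) b

_[_]ᵍᵇˢ : List Br → List Tm → List Br
bs [ σ ]ᵍᵇˢ = gsubBs (toGSub σ) bs

infix 4 _⊢ᵍ_∶_

data _⊢ᵍ_∶_ : GCtx → List Tm → GCtx → Set where
  g-nil  : ∀ {Ψ} → CoreG Ψ → Ψ ⊢ᵍ [] ∶ []
  g-cons : ∀ {Ψ σ Φ Γ t T} → Ψ ⊢ᵍ σ ∶ Φ → Ψ ︔ Γ ⊢[ L0 ] t ∶ T →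
           Ψ ⊢ᵍ (t ∷ σ) ∶ ((Γ , T) ∷ Φ)

module Submission where

-- The only interesting case is u^δ with σ(u) = t:
-- t is a core term typed in Δ, so t[δ[σ]] is typed by the local substitution
-- lemma.  Under global binders (letbox and the succ, λ and application
-- patterns) σ is extended by u/u, so the induction runs over substitutions
-- whose entries are either kept variables or core terms, and those terms must
-- be weakened by a global renaming.  All three operations preserve branch
-- heads, hence covering.

open import Defs
open import Data.List using ([]; _∷_; map)
open import Data.List.Membership.Propositional using (_∈_)
open import Data.List.Relation.Unary.All using (All; []; _∷_; head; tail)
open import Data.List.Relation.Unary.All.Properties using (map⁺; map⁻)
open import Data.List.Relation.Unary.Unique.Propositional using (Unique)
open import Data.Product using (_×_; _,_)
open import Relation.Binary.PropositionalEquality using (_≡_; refl; sym; cong₂; subst)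

Core⇒Valid : ∀ {T} → Core T → Valid T
Core⇒Valid c-Nat       = v-Nat
Core⇒Valid (c-⇒ cS cT) = v-⇒ (Core⇒Valid cS) (Core⇒Valid cT)

CtxOK-∷ : ∀ i {S Γ} → Core S → CtxOK i Γ → CtxOK i (S ∷ Γ)
CtxOK-∷ L0 cS ok = cS ∷ ok
CtxOK-∷ L1 cS ok = Core⇒Valid cS ∷ ok

CtxOK-tail : ∀ i {S Γ} → CtxOK i (S ∷ Γ) → CtxOK i Γ
CtxOK-tail L0 = tail
CtxOK-tail L1 = tail

CtxOK-replaceTail : ∀ i {S Γ Γ′} → CtxOK i (S ∷ Γ) → CtxOK i Γ′ → CtxOK i (S ∷ Γ′)
CtxOK-replaceTail L0 (cS ∷ _) ok = cS ∷ ok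
CtxOK-replaceTail L1 (vS ∷ _) ok = vS ∷ ok

mutual
  ⊢-CtxOK : ∀ {Ψ Γ i t T} → Ψ ︔ Γ ⊢[ i ] t ∶ T → CtxOK i Γ
  ⊢-CtxOK (t-zero _ ok)         = ok
  ⊢-CtxOK (t-var _ ok _)        = ok
  ⊢-CtxOK (t-gvar ⊢δ _)         = ⊢s-CtxOK ⊢δ
  ⊢-CtxOK (t-succ ⊢t)           = ⊢-CtxOK ⊢t
  ⊢-CtxOK {i = i} (t-lam ⊢t)    = CtxOK-tail i (⊢-CtxOK ⊢t)
  ⊢-CtxOK (t-app ⊢s _)          = ⊢-CtxOK ⊢s
  ⊢-CtxOK (t-box ok _)          = ok
  ⊢-CtxOK (t-letbox ⊢s _)       = ⊢-CtxOK ⊢s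
  ⊢-CtxOK (t-match ⊢s _)        = ⊢-CtxOK ⊢s

  ⊢s-CtxOK : ∀ {Ψ Γ i δ Δ} → Ψ ︔ Γ ⊢s[ i ] δ ∶ Δ → CtxOK i Γ
  ⊢s-CtxOK (s-nil _ ok)  = ok
  ⊢s-CtxOK (s-cons ⊢δ _) = ⊢s-CtxOK ⊢δ

mutual
  ⊢-CoreG : ∀ {Ψ Γ i t T} → Ψ ︔ Γ ⊢[ i ] t ∶ T → CoreG Ψ
  ⊢-CoreG (t-zero cΨ _)    = cΨ
  ⊢-CoreG (t-var cΨ _ _)   = cΨ
  ⊢-CoreG (t-gvar ⊢δ _)    = ⊢s-CoreG ⊢δ
  ⊢-CoreG (t-succ ⊢t)      = ⊢-CoreG ⊢t
  ⊢-CoreG (t-lam ⊢t)       = ⊢-CoreG ⊢t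
  ⊢-CoreG (t-app ⊢s _)     = ⊢-CoreG ⊢s
  ⊢-CoreG (t-box _ ⊢t)     = ⊢-CoreG ⊢t
  ⊢-CoreG (t-letbox ⊢s _)  = ⊢-CoreG ⊢s
  ⊢-CoreG (t-match ⊢s _)   = ⊢-CoreG ⊢s

  ⊢s-CoreG : ∀ {Ψ Γ i δ Δ} → Ψ ︔ Γ ⊢s[ i ] δ ∶ Δ → CoreG Ψ
  ⊢s-CoreG (s-nil cΨ _)  = cΨ
  ⊢s-CoreG (s-cons ⊢δ _) = ⊢s-CoreG ⊢δ

Covers-cong : ∀ {Δ T bs bs′} → map headOf bs′ ≡ map headOf bs →
              Covers Δ T bs → Covers Δ T bs′
Covers-cong eq (applicable , complete , unique) =
  map⁻ (subst (All (Applicable _ _)) (sym eq) (map⁺ applicable)) ,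
  (λ h a → subst (h ∈_) (sym eq) (complete h a)) ,
  subst Unique (sym eq) unique

GRenaming : GCtx → GCtx → Ren → Set
GRenaming Ψ Ψ′ r = ∀ {u B} → Ψ ∋ u ⦂ B → Ψ′ ∋ r u ⦂ B

GRenaming-ext : ∀ {Ψ Ψ′ r B} → GRenaming Ψ Ψ′ r → GRenaming (B ∷ Ψ) (B ∷ Ψ′) (ext r)
GRenaming-ext ⊢r here      = here
GRenaming-ext ⊢r (there l) = there (⊢r l)

headOf-grenB : ∀ r b → headOf (grenB r b) ≡ headOf b
headOf-grenB r (bvar x t) = refl
headOf-grenB r (bzero t)  = refl
headOf-grenB r (bsucc t)  = refl
headOf-grenB r (blam t)   = refl
headOf-grenB r (bapp t)   = refl

map-headOf-grenBs : ∀ r bs → map headOf (grenBs r bs) ≡ map headOf bs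
map-headOf-grenBs r []       = refl
map-headOf-grenBs r (b ∷ bs) = cong₂ _∷_ (headOf-grenB r b) (map-headOf-grenBs r bs)

mutual
  gren-⊢ : ∀ {Ψ Ψ′ r Γ i t T} → CoreG Ψ′ → GRenaming Ψ Ψ′ r →
           Ψ ︔ Γ ⊢[ i ] t ∶ T → Ψ′ ︔ Γ ⊢[ i ] gren r t ∶ T
  gren-⊢ cΨ′ ⊢r (t-zero _ ok)     = t-zero cΨ′ ok
  gren-⊢ cΨ′ ⊢r (t-var _ ok x)    = t-var cΨ′ ok x
  gren-⊢ cΨ′ ⊢r (t-gvar ⊢δ u)     = t-gvar (grens-⊢s cΨ′ ⊢r ⊢δ) (⊢r u)
  gren-⊢ cΨ′ ⊢r (t-succ ⊢t)       = t-succ (gren-⊢ cΨ′ ⊢r ⊢t)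
  gren-⊢ cΨ′ ⊢r (t-lam ⊢t)        = t-lam (gren-⊢ cΨ′ ⊢r ⊢t)
  gren-⊢ cΨ′ ⊢r (t-app ⊢s ⊢t)     = t-app (gren-⊢ cΨ′ ⊢r ⊢s) (gren-⊢ cΨ′ ⊢r ⊢t)
  gren-⊢ cΨ′ ⊢r (t-box ok ⊢t)     = t-box ok (gren-⊢ cΨ′ ⊢r ⊢t)
  gren-⊢ cΨ′ ⊢r (t-letbox ⊢s ⊢t)  =
    t-letbox (gren-⊢ cΨ′ ⊢r ⊢s) (gren-⊢ (head (⊢-CoreG ⊢t) ∷ cΨ′) (GRenaming-ext ⊢r) ⊢t)
  gren-⊢ cΨ′ ⊢r (t-match ⊢s ⊢bs)  = t-match (gren-⊢ cΨ′ ⊢r ⊢s) (grenBs-⊢ᵇˢ cΨ′ ⊢r ⊢bs)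

  grens-⊢s : ∀ {Ψ Ψ′ r Γ i δ Δ} → CoreG Ψ′ → GRenaming Ψ Ψ′ r →
             Ψ ︔ Γ ⊢s[ i ] δ ∶ Δ → Ψ′ ︔ Γ ⊢s[ i ] grens r δ ∶ Δ
  grens-⊢s cΨ′ ⊢r (s-nil _ ok)     = s-nil cΨ′ ok
  grens-⊢s cΨ′ ⊢r (s-cons ⊢δ ⊢t)   = s-cons (grens-⊢s cΨ′ ⊢r ⊢δ) (gren-⊢ cΨ′ ⊢r ⊢t)

  grenB-⊢ᵇ : ∀ {Ψ Ψ′ r Γ b Δ T T′} → CoreG Ψ′ → GRenaming Ψ Ψ′ r →
             Ψ ︔ Γ ⊢ᵇ b ∶ Δ ▸ T ⇛ T′ → Ψ′ ︔ Γ ⊢ᵇ grenB r b ∶ Δ ▸ T ⇛ T′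
  grenB-⊢ᵇ cΨ′ ⊢r (b-var cΔ x ⊢t) = b-var cΔ x (gren-⊢ cΨ′ ⊢r ⊢t)
  grenB-⊢ᵇ cΨ′ ⊢r (b-zero cΔ ⊢t)  = b-zero cΔ (gren-⊢ cΨ′ ⊢r ⊢t)
  grenB-⊢ᵇ cΨ′ ⊢r (b-succ ⊢t)     =
    b-succ (gren-⊢ (head (⊢-CoreG ⊢t) ∷ cΨ′) (GRenaming-ext ⊢r) ⊢t)
  grenB-⊢ᵇ cΨ′ ⊢r (b-lam ⊢t)      =
    b-lam (gren-⊢ (head (⊢-CoreG ⊢t) ∷ cΨ′) (GRenaming-ext ⊢r) ⊢t)
  grenB-⊢ᵇ cΨ′ ⊢r (b-app ⊢t)      = b-app λ S cS →
    let cΨ = ⊢-CoreG (⊢t S cS) in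
    gren-⊢ (head cΨ ∷ head (tail cΨ) ∷ cΨ′) (GRenaming-ext (GRenaming-ext ⊢r)) (⊢t S cS)

  grenBs-All : ∀ {Ψ Ψ′ r Γ bs Δ T T′} → CoreG Ψ′ → GRenaming Ψ Ψ′ r →
               All (λ b → Ψ ︔ Γ ⊢ᵇ b ∶ Δ ▸ T ⇛ T′) bs →
               All (λ b → Ψ′ ︔ Γ ⊢ᵇ b ∶ Δ ▸ T ⇛ T′) (grenBs r bs)
  grenBs-All cΨ′ ⊢r []           = []
  grenBs-All cΨ′ ⊢r (⊢b ∷ ⊢bs)   = grenB-⊢ᵇ cΨ′ ⊢r ⊢b ∷ grenBs-All cΨ′ ⊢r ⊢bs

  grenBs-⊢ᵇˢ : ∀ {Ψ Ψ′ r Γ bs Δ T T′} → CoreG Ψ′ → GRenaming Ψ Ψ′ r →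
               Ψ ︔ Γ ⊢ᵇˢ bs ∶ Δ ▸ T ⇛ T′ → Ψ′ ︔ Γ ⊢ᵇˢ grenBs r bs ∶ Δ ▸ T ⇛ T′
  grenBs-⊢ᵇˢ {r = r} cΨ′ ⊢r (covering {bs = bs} ⊢bs cover) =
    covering (grenBs-All cΨ′ ⊢r ⊢bs) (Covers-cong (map-headOf-grenBs r bs) cover)

LRenaming : Ctx → Ctx → Ren → Set
LRenaming Γ Γ′ ρ = ∀ {x T} → Γ ∋ x ⦂ T → Γ′ ∋ ρ x ⦂ T

LRenaming-ext : ∀ {Γ Γ′ ρ S} → LRenaming Γ Γ′ ρ → LRenaming (S ∷ Γ) (S ∷ Γ′) (ext ρ)
LRenaming-ext ⊢ρ here      = here
LRenaming-ext ⊢ρ (there x) = there (⊢ρ x)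

headOf-lrenB : ∀ ρ b → headOf (lrenB ρ b) ≡ headOf b
headOf-lrenB ρ (bvar x t) = refl
headOf-lrenB ρ (bzero t)  = refl
headOf-lrenB ρ (bsucc t)  = refl
headOf-lrenB ρ (blam t)   = refl
headOf-lrenB ρ (bapp t)   = refl

map-headOf-lrenBs : ∀ ρ bs → map headOf (lrenBs ρ bs) ≡ map headOf bs
map-headOf-lrenBs ρ []       = refl
map-headOf-lrenBs ρ (b ∷ bs) = cong₂ _∷_ (headOf-lrenB ρ b) (map-headOf-lrenBs ρ bs)

mutual
  lren-⊢ : ∀ {Ψ Γ Γ′ ρ i t T} → CtxOK i Γ′ → LRenaming Γ Γ′ ρ →
           Ψ ︔ Γ ⊢[ i ] t ∶ T → Ψ ︔ Γ′ ⊢[ i ] lren ρ t ∶ T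
  lren-⊢ ok ⊢ρ (t-zero cΨ _)      = t-zero cΨ ok
  lren-⊢ ok ⊢ρ (t-var cΨ _ x)     = t-var cΨ ok (⊢ρ x)
  lren-⊢ ok ⊢ρ (t-gvar ⊢δ u)      = t-gvar (lrens-⊢s ok ⊢ρ ⊢δ) u
  lren-⊢ ok ⊢ρ (t-succ ⊢t)        = t-succ (lren-⊢ ok ⊢ρ ⊢t)
  lren-⊢ {i = i} ok ⊢ρ (t-lam ⊢t) =
    t-lam (lren-⊢ (CtxOK-replaceTail i (⊢-CtxOK ⊢t) ok) (LRenaming-ext ⊢ρ) ⊢t)
  lren-⊢ ok ⊢ρ (t-app ⊢s ⊢t)      = t-app (lren-⊢ ok ⊢ρ ⊢s) (lren-⊢ ok ⊢ρ ⊢t)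
  lren-⊢ ok ⊢ρ (t-box _ ⊢t)       = t-box ok ⊢t
  lren-⊢ ok ⊢ρ (t-letbox ⊢s ⊢t)   = t-letbox (lren-⊢ ok ⊢ρ ⊢s) (lren-⊢ ok ⊢ρ ⊢t)
  lren-⊢ ok ⊢ρ (t-match ⊢s ⊢bs)   = t-match (lren-⊢ ok ⊢ρ ⊢s) (lrenBs-⊢ᵇˢ ok ⊢ρ ⊢bs)

  lrens-⊢s : ∀ {Ψ Γ Γ′ ρ i δ Δ} → CtxOK i Γ′ → LRenaming Γ Γ′ ρ →
             Ψ ︔ Γ ⊢s[ i ] δ ∶ Δ → Ψ ︔ Γ′ ⊢s[ i ] lrens ρ δ ∶ Δ
  lrens-⊢s ok ⊢ρ (s-nil cΨ _)    = s-nil cΨ ok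
  lrens-⊢s ok ⊢ρ (s-cons ⊢δ ⊢t)  = s-cons (lrens-⊢s ok ⊢ρ ⊢δ) (lren-⊢ ok ⊢ρ ⊢t)

  lrenB-⊢ᵇ : ∀ {Ψ Γ Γ′ ρ b Δ T T′} → TypeCtx Γ′ → LRenaming Γ Γ′ ρ →
             Ψ ︔ Γ ⊢ᵇ b ∶ Δ ▸ T ⇛ T′ → Ψ ︔ Γ′ ⊢ᵇ lrenB ρ b ∶ Δ ▸ T ⇛ T′
  lrenB-⊢ᵇ ok ⊢ρ (b-var cΔ x ⊢t) = b-var cΔ x (lren-⊢ ok ⊢ρ ⊢t)
  lrenB-⊢ᵇ ok ⊢ρ (b-zero cΔ ⊢t)  = b-zero cΔ (lren-⊢ ok ⊢ρ ⊢t)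
  lrenB-⊢ᵇ ok ⊢ρ (b-succ ⊢t)     = b-succ (lren-⊢ ok ⊢ρ ⊢t)
  lrenB-⊢ᵇ ok ⊢ρ (b-lam ⊢t)      = b-lam (lren-⊢ ok ⊢ρ ⊢t)
  lrenB-⊢ᵇ ok ⊢ρ (b-app ⊢t)      = b-app λ S cS → lren-⊢ ok ⊢ρ (⊢t S cS)

  lrenBs-All : ∀ {Ψ Γ Γ′ ρ bs Δ T T′} → TypeCtx Γ′ → LRenaming Γ Γ′ ρ →
               All (λ b → Ψ ︔ Γ ⊢ᵇ b ∶ Δ ▸ T ⇛ T′) bs →
               All (λ b → Ψ ︔ Γ′ ⊢ᵇ b ∶ Δ ▸ T ⇛ T′) (lrenBs ρ bs)
  lrenBs-All ok ⊢ρ []          = []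
  lrenBs-All ok ⊢ρ (⊢b ∷ ⊢bs)  = lrenB-⊢ᵇ ok ⊢ρ ⊢b ∷ lrenBs-All ok ⊢ρ ⊢bs

  lrenBs-⊢ᵇˢ : ∀ {Ψ Γ Γ′ ρ bs Δ T T′} → TypeCtx Γ′ → LRenaming Γ Γ′ ρ →
               Ψ ︔ Γ ⊢ᵇˢ bs ∶ Δ ▸ T ⇛ T′ → Ψ ︔ Γ′ ⊢ᵇˢ lrenBs ρ bs ∶ Δ ▸ T ⇛ T′
  lrenBs-⊢ᵇˢ {ρ = ρ} ok ⊢ρ (covering {bs = bs} ⊢bs cover) =
    covering (lrenBs-All ok ⊢ρ ⊢bs) (Covers-cong (map-headOf-lrenBs ρ bs) cover)

lookupTm-⊢ : ∀ {Ψ Γ i δ Δ x T} → Ψ ︔ Γ ⊢s[ i ] δ ∶ Δ → Δ ∋ x ⦂ T →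
             Ψ ︔ Γ ⊢[ i ] lookupTm δ x ∶ T
lookupTm-⊢ (s-cons ⊢δ ⊢t) here      = ⊢t
lookupTm-⊢ (s-cons ⊢δ ⊢t) (there x) = lookupTm-⊢ ⊢δ x

-- Local substitution is only ever applied to core (layer-0) terms, which have
-- no box, letbox or match; the result may live at either layer.
mutual
  lsub-⊢ : ∀ {Ψ Γ i δ Δ t T} → Ψ ︔ Γ ⊢s[ i ] δ ∶ Δ →
           Ψ ︔ Δ ⊢[ L0 ] t ∶ T → Ψ ︔ Γ ⊢[ i ] lsub δ t ∶ T
  lsub-⊢ ⊢δ (t-zero cΨ _)    = t-zero cΨ (⊢s-CtxOK ⊢δ)
  lsub-⊢ ⊢δ (t-var _ _ x)    = lookupTm-⊢ ⊢δ x
  lsub-⊢ ⊢δ (t-gvar ⊢δ′ u)   = t-gvar (lsubs-⊢s ⊢δ ⊢δ′) u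
  lsub-⊢ ⊢δ (t-succ ⊢t)      = t-succ (lsub-⊢ ⊢δ ⊢t)
  lsub-⊢ {i = i} ⊢δ (t-lam ⊢t) = t-lam (lsub-⊢ ⊢δ,x ⊢t)
    where
    ok : CtxOK i (_ ∷ _)
    ok = CtxOK-∷ i (head (⊢-CtxOK ⊢t)) (⊢s-CtxOK ⊢δ)
    ⊢δ,x = s-cons (lrens-⊢s ok there ⊢δ) (t-var (⊢s-CoreG ⊢δ) ok here)
  lsub-⊢ ⊢δ (t-app ⊢s ⊢t)    = t-app (lsub-⊢ ⊢δ ⊢s) (lsub-⊢ ⊢δ ⊢t)

  lsubs-⊢s : ∀ {Ψ Γ i δ Δ δ′ Δ′} → Ψ ︔ Γ ⊢s[ i ] δ ∶ Δ →
             Ψ ︔ Δ ⊢s[ L0 ] δ′ ∶ Δ′ → Ψ ︔ Γ ⊢s[ i ] lsubs δ δ′ ∶ Δ′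
  lsubs-⊢s ⊢δ (s-nil cΨ _)     = s-nil cΨ (⊢s-CtxOK ⊢δ)
  lsubs-⊢s ⊢δ (s-cons ⊢δ′ ⊢t)  = s-cons (lsubs-⊢s ⊢δ ⊢δ′) (lsub-⊢ ⊢δ ⊢t)

data EntryOK (Ψ : GCtx) (Δ : Ctx) (T : Ty) : GEnt → Set where
  keep-ok : ∀ {u} → Ψ ∋ u ⦂ (Δ , T) → EntryOK Ψ Δ T (keep u)
  inst-ok : ∀ {t} → Ψ ︔ Δ ⊢[ L0 ] t ∶ T → EntryOK Ψ Δ T (inst t)

record GSubOK (Ψ Φ : GCtx) (σ : GSub) : Set where
  field
    coreG : CoreG Ψ
    entry : ∀ {u Δ T} → Φ ∋ u ⦂ (Δ , T) → EntryOK Ψ Δ T (σ u)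
open GSubOK

shiftEnt-EntryOK : ∀ {Ψ Δ T B e} → CoreG (B ∷ Ψ) → EntryOK Ψ Δ T e →
                   EntryOK (B ∷ Ψ) Δ T (shiftEnt e)
shiftEnt-EntryOK cBΨ (keep-ok u)  = keep-ok (there u)
shiftEnt-EntryOK cBΨ (inst-ok ⊢t) = inst-ok (gren-⊢ cBΨ there ⊢t)

extG-GSubOK : ∀ {Ψ Φ σ B} → CoreBinding B → GSubOK Ψ Φ σ → GSubOK (B ∷ Ψ) (B ∷ Φ) (extG σ)
coreG (extG-GSubOK cB ⊢σ)           = cB ∷ coreG ⊢σ
entry (extG-GSubOK cB ⊢σ) here      = keep-ok here
entry (extG-GSubOK cB ⊢σ) (there u) = shiftEnt-EntryOK (cB ∷ coreG ⊢σ) (entry ⊢σ u)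

toGSub-GSubOK : ∀ {Ψ σ Φ} → Ψ ⊢ᵍ σ ∶ Φ → GSubOK Ψ Φ (toGSub σ)
coreG (toGSub-GSubOK (g-nil cΨ))            = cΨ
entry (toGSub-GSubOK (g-nil cΨ)) ()
coreG (toGSub-GSubOK (g-cons ⊢σ ⊢t))        = coreG (toGSub-GSubOK ⊢σ)
entry (toGSub-GSubOK (g-cons ⊢σ ⊢t)) here      = inst-ok ⊢t
entry (toGSub-GSubOK (g-cons ⊢σ ⊢t)) (there u) = entry (toGSub-GSubOK ⊢σ) u

headOf-gsubB : ∀ σ b → headOf (gsubB σ b) ≡ headOf b
headOf-gsubB σ (bvar x t) = refl
headOf-gsubB σ (bzero t)  = refl
headOf-gsubB σ (bsucc t)  = refl
headOf-gsubB σ (blam t)   = refl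
headOf-gsubB σ (bapp t)   = refl

map-headOf-gsubBs : ∀ σ bs → map headOf (gsubBs σ bs) ≡ map headOf bs
map-headOf-gsubBs σ []       = refl
map-headOf-gsubBs σ (b ∷ bs) = cong₂ _∷_ (headOf-gsubB σ b) (map-headOf-gsubBs σ bs)

mutual
  gsub-⊢ : ∀ {Ψ Φ σ Γ i t T} → GSubOK Ψ Φ σ →
           Φ ︔ Γ ⊢[ i ] t ∶ T → Ψ ︔ Γ ⊢[ i ] gsub σ t ∶ T
  gsub-⊢ ⊢σ (t-zero _ ok)     = t-zero (coreG ⊢σ) ok
  gsub-⊢ ⊢σ (t-var _ ok x)    = t-var (coreG ⊢σ) ok x
  gsub-⊢ {σ = σ} ⊢σ (t-gvar {u = u} ⊢δ u∈Φ) with σ u | entry ⊢σ u∈Φ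
  ... | keep u′ | keep-ok u′∈Ψ = t-gvar (gsubs-⊢s ⊢σ ⊢δ) u′∈Ψ
  ... | inst t  | inst-ok ⊢t   = lsub-⊢ (gsubs-⊢s ⊢σ ⊢δ) ⊢t
  gsub-⊢ ⊢σ (t-succ ⊢t)       = t-succ (gsub-⊢ ⊢σ ⊢t)
  gsub-⊢ ⊢σ (t-lam ⊢t)        = t-lam (gsub-⊢ ⊢σ ⊢t)
  gsub-⊢ ⊢σ (t-app ⊢s ⊢t)     = t-app (gsub-⊢ ⊢σ ⊢s) (gsub-⊢ ⊢σ ⊢t)
  gsub-⊢ ⊢σ (t-box ok ⊢t)     = t-box ok (gsub-⊢ ⊢σ ⊢t)
  gsub-⊢ ⊢σ (t-letbox ⊢s ⊢t)  =
    t-letbox (gsub-⊢ ⊢σ ⊢s) (gsub-⊢ (extG-GSubOK (head (⊢-CoreG ⊢t)) ⊢σ) ⊢t)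
  gsub-⊢ ⊢σ (t-match ⊢s ⊢bs)  = t-match (gsub-⊢ ⊢σ ⊢s) (gsubBs-⊢ᵇˢ ⊢σ ⊢bs)

  gsubs-⊢s : ∀ {Ψ Φ σ Γ i δ Δ} → GSubOK Ψ Φ σ →
             Φ ︔ Γ ⊢s[ i ] δ ∶ Δ → Ψ ︔ Γ ⊢s[ i ] gsubs σ δ ∶ Δ
  gsubs-⊢s ⊢σ (s-nil _ ok)    = s-nil (coreG ⊢σ) ok
  gsubs-⊢s ⊢σ (s-cons ⊢δ ⊢t)  = s-cons (gsubs-⊢s ⊢σ ⊢δ) (gsub-⊢ ⊢σ ⊢t)

  gsubB-⊢ᵇ : ∀ {Ψ Φ σ Γ b Δ T T′} → GSubOK Ψ Φ σ →
             Φ ︔ Γ ⊢ᵇ b ∶ Δ ▸ T ⇛ T′ → Ψ ︔ Γ ⊢ᵇ gsubB σ b ∶ Δ ▸ T ⇛ T′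
  gsubB-⊢ᵇ ⊢σ (b-var cΔ x ⊢t) = b-var cΔ x (gsub-⊢ ⊢σ ⊢t)
  gsubB-⊢ᵇ ⊢σ (b-zero cΔ ⊢t)  = b-zero cΔ (gsub-⊢ ⊢σ ⊢t)
  gsubB-⊢ᵇ ⊢σ (b-succ ⊢t)     = b-succ (gsub-⊢ (extG-GSubOK (head (⊢-CoreG ⊢t)) ⊢σ) ⊢t)
  gsubB-⊢ᵇ ⊢σ (b-lam ⊢t)      = b-lam (gsub-⊢ (extG-GSubOK (head (⊢-CoreG ⊢t)) ⊢σ) ⊢t)
  gsubB-⊢ᵇ ⊢σ (b-app ⊢t)      = b-app λ S cS →
    let cΨ = ⊢-CoreG (⊢t S cS) in
    gsub-⊢ (extG-GSubOK (head cΨ) (extG-GSubOK (head (tail cΨ)) ⊢σ)) (⊢t S cS)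

  gsubBs-All : ∀ {Ψ Φ σ Γ bs Δ T T′} → GSubOK Ψ Φ σ →
               All (λ b → Φ ︔ Γ ⊢ᵇ b ∶ Δ ▸ T ⇛ T′) bs →
               All (λ b → Ψ ︔ Γ ⊢ᵇ b ∶ Δ ▸ T ⇛ T′) (gsubBs σ bs)
  gsubBs-All ⊢σ []          = []
  gsubBs-All ⊢σ (⊢b ∷ ⊢bs)  = gsubB-⊢ᵇ ⊢σ ⊢b ∷ gsubBs-All ⊢σ ⊢bs

  gsubBs-⊢ᵇˢ : ∀ {Ψ Φ σ Γ bs Δ T T′} → GSubOK Ψ Φ σ →
               Φ ︔ Γ ⊢ᵇˢ bs ∶ Δ ▸ T ⇛ T′ → Ψ ︔ Γ ⊢ᵇˢ gsubBs σ bs ∶ Δ ▸ T ⇛ T′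
  gsubBs-⊢ᵇˢ {σ = σ} ⊢σ (covering {bs = bs} ⊢bs cover) =
    covering (gsubBs-All ⊢σ ⊢bs) (Covers-cong (map-headOf-gsubBs σ bs) cover)

mainTheorem19 :
    (∀ {i Ψ Φ σ Γ t T} → Ψ ⊢ᵍ σ ∶ Φ → Φ ︔ Γ ⊢[ i ] t ∶ T →
       Ψ ︔ Γ ⊢[ i ] t [ σ ]ᵍ ∶ T)
    × (∀ {i Ψ Φ σ Γ δ Δ} → Ψ ⊢ᵍ σ ∶ Φ → Φ ︔ Γ ⊢s[ i ] δ ∶ Δ →
       Ψ ︔ Γ ⊢s[ i ] δ [ σ ]ᵍˢ ∶ Δ)
    × (∀ {Ψ Φ σ Γ b Δ T T'} → Ψ ⊢ᵍ σ ∶ Φ → Φ ︔ Γ ⊢ᵇ b ∶ Δ ▸ T ⇛ T' →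
       Ψ ︔ Γ ⊢ᵇ b [ σ ]ᵍᵇ ∶ Δ ▸ T ⇛ T')
    × (∀ {Ψ Φ σ Γ bs Δ T T'} → Ψ ⊢ᵍ σ ∶ Φ → Φ ︔ Γ ⊢ᵇˢ bs ∶ Δ ▸ T ⇛ T' →
       Ψ ︔ Γ ⊢ᵇˢ bs [ σ ]ᵍᵇˢ ∶ Δ ▸ T ⇛ T')
mainTheorem19 =
    (λ ⊢σ → gsub-⊢ (toGSub-GSubOK ⊢σ))
  , (λ ⊢σ → gsubs-⊢s (toGSub-GSubOK ⊢σ))
  , (λ ⊢σ → gsubB-⊢ᵇ (toGSub-GSubOK ⊢σ))
  , (λ ⊢σ → gsubBs-⊢ᵇˢ (toGSub-GSubOK ⊢σ))
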